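{- Let $q\ge1$ be an integer. For every continuous map $f:\Delta_{2(q-1)}^{\le 0}\to\mathbb{R}$ there are at least $(q-1)!$ winding partitions.
   Context: $\Delta_{2(q-1)}^{\le0}$ is the vertex set ($2q-1$ points) of the $2(q-1)$-simplex $\Delta_{2(q-1)}$, and $\Delta_{2(q-1)}^{\le1}$ its $1$-skeleton. A winding partition for $f$ is a set of $q$ pairwise disjoint faces $\sigma_1,\dots,\sigma_q$ of $\Delta_{2(q-1)}^{\le 1}$ (vertices or edges) for which there is a point $p\in\mathbb{R}$ such that for each $i$: if $\sigma_i$ is a vertex then $p=f(\sigma_i)$; if $\sigma_i$ is an edge with endpoints $u,v$ then $p$ lies in the closed interval between $f(u)$ and $f(v)$. -}

module Defs where

open import Level using (Level; _⊔_)
open import Data.Nat.Base using (ℕ; suc; _*_; _∸_; _!)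
open import Data.Fin.Base using (Fin) renaming (_<_ to _<ᶠ_)
open import Data.Product.Base using (Σ; ∃; _×_)
open import Data.Sum.Base using (_⊎_)
open import Relation.Binary.Bundles using (TotalOrder)
open import Relation.Binary.PropositionalEquality using (_≡_; _≢_)
open import Relation.Nullary using (¬_)

-- Faces of the 1-skeleton of the simplex with vertex set Fin n:
-- a vertex, or an edge {u,v} written canonically with u < v.
data Face (n : ℕ) : Set where
  vertex : Fin n → Face n
  edge   : (u v : Fin n) → u <ᶠ v → Face n

_∈F_ : ∀ {n} → Fin n → Face n → Set
x ∈F vertex v   = x ≡ v
x ∈F edge u v _ = x ≡ u ⊎ x ≡ v

-- number of vertices of the simplex Δ_{2(q-1)}: 2q-1 = 2(q-1)+1
nV : ℕ → ℕ
nV q = suc (2 * (q ∸ 1))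

module _ {c ℓ₁ ℓ₂ : Level} (O : TotalOrder c ℓ₁ ℓ₂) where
  open TotalOrder O renaming (Carrier to R)

  Hits : ∀ {n} → (Fin n → R) → R → Face n → Set (ℓ₁ ⊔ ℓ₂)
  Hits f p (vertex v)   = Level.Lift (ℓ₁ ⊔ ℓ₂) (p ≈ f v)
  Hits f p (edge u v _) = Level.Lift (ℓ₁ ⊔ ℓ₂) ((f u ≤ p × p ≤ f v) ⊎ (f v ≤ p × p ≤ f u))

  -- σ : Fin q → Face n is a family of q pairwise disjoint faces which is a
  -- winding partition for f (the partition is the set {σ i | i : Fin q})
  IsWindingPartition : ∀ {n} (q : ℕ) → (Fin n → R) → (Fin q → Face n) → Set (c ⊔ ℓ₁ ⊔ ℓ₂)
  IsWindingPartition q f σ =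
    (∀ (i j : Fin q) (x : Fin _) → x ∈F σ i → x ∈F σ j → i ≡ j)
    × Σ R (λ p → ∀ i → Hits f p (σ i))

SameSet : ∀ {n q} → (Fin q → Face n) → (Fin q → Face n) → Set
SameSet σ τ = (∀ i → ∃ λ j → σ i ≡ τ j) × (∀ j → ∃ λ i → τ j ≡ σ i)

AtLeastWinding : ∀ {c ℓ₁ ℓ₂} (O : TotalOrder c ℓ₁ ℓ₂) (q k : ℕ) →
  (Fin (nV q) → TotalOrder.Carrier O) → Set (c ⊔ ℓ₁ ⊔ ℓ₂)
AtLeastWinding O q k f =
  Σ (Fin k → Fin q → Face (nV q)) λ W →
    (∀ a → IsWindingPartition O q f (W a))
    × (∀ a b → a ≢ b → ¬ SameSet (W a) (W b))

{-# OPTIONS --safe #-}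

-- Sort the 2m+1 = 2q-1 vertices by their values and let c be the median vertex, so
-- that m vertices lie weakly below f c and m weakly above it. For every
-- bijection π between the lower and the upper vertices, the vertex c together
-- with the m edges {lᵢ, u_{π i}} is a winding partition at the point f c, and
-- distinct bijections give distinct sets of faces. There are m! of them.

module Submission where

open import Defs
open import Level using (Level; lift)
open import Data.Nat.Base using (ℕ; _≥_; _∸_; _!; zero; suc; _+_; _*_; z<s; s≤s)
  renaming (_≤_ to _≤ℕ_; _<_ to _<ℕ_)
import Data.Nat.Properties as ℕ
open import Data.Fin.Base using (Fin; zero; suc; toℕ; fromℕ<; punchIn; remQuot; combine)
  renaming (_≤_ to _≤ᶠ_)
open import Data.Fin.Properties
  using (toℕ-fromℕ<; toℕ-injective; toℕ<n; punchIn-injective; punchInᵢ≢i; <-cmp; combine-remQuot)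
open import Data.Vec.Functional using (_∷_)
open import Data.Product.Base using (∃; _×_; _,_; proj₁; proj₂; uncurry)
open import Data.Sum.Base using (_⊎_; inj₁; inj₂)
open import Function.Base using (_∘_)
open import Function.Definitions using (Injective)
open import Relation.Binary.Bundles using (TotalOrder)
open import Relation.Binary.Definitions using (tri<; tri≈; tri>)
open import Relation.Binary.PropositionalEquality
  using (_≡_; _≢_; refl; sym; trans; cong; cong₂; subst; subst₂; module ≡-Reasoning)
open import Relation.Nullary using (contradiction)

insert : ∀ {n} → Fin (suc n) → (Fin n → Fin n) → Fin (suc n) → Fin (suc n)
insert k π = k ∷ punchIn k ∘ π

insert-injective : ∀ {n} k {π : Fin n → Fin n} → Injective _≡_ _≡_ π → Injective _≡_ _≡_ (insert k π)
insert-injective k π-inj {zero}  {zero}  _ = refl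
insert-injective k π-inj {zero}  {suc j} e = contradiction (sym e) (punchInᵢ≢i k _)
insert-injective k π-inj {suc i} {zero}  e = contradiction e (punchInᵢ≢i k _)
insert-injective k π-inj {suc i} {suc j} e = cong suc (π-inj (punchIn-injective k _ _ e))

insert-cancel : ∀ {n} {k k′} {π π′ : Fin n → Fin n} → (∀ i → insert k π i ≡ insert k′ π′ i) →
                k ≡ k′ × (∀ i → π i ≡ π′ i)
insert-cancel {k = k} same with same zero
... | refl = refl , λ i → punchIn-injective k _ _ (same (suc i))

-- The factorial number system: the leading digit of x is the image of 0, the
-- remaining digits enumerate the rest of the permutation.
permutation : ∀ n → Fin (n !) → Fin n → Fin n
permutation zero    _ ()
permutation (suc n) x = insert (proj₁ (remQuot {suc n} (n !) x))
                               (permutation n (proj₂ (remQuot {suc n} (n !) x)))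

permutation-injective : ∀ n x → Injective _≡_ _≡_ (permutation n x)
permutation-injective zero    _ {()}
permutation-injective (suc n) x = insert-injective _ (permutation-injective n _)

permutation-cancel : ∀ n {x y} → (∀ i → permutation n x i ≡ permutation n y i) → x ≡ y
permutation-cancel zero    {zero} {zero} _ = refl
permutation-cancel (suc n) {x} {y} same with insert-cancel same
... | k≡k′ , π≡π′ = begin
  x                                          ≡⟨ combine-remQuot {suc n} (n !) x ⟨
  uncurry combine (remQuot {suc n} (n !) x)  ≡⟨ cong₂ combine k≡k′ (permutation-cancel n π≡π′) ⟩
  uncurry combine (remQuot {suc n} (n !) y)  ≡⟨ combine-remQuot {suc n} (n !) y ⟩
  y                                          ∎
  where open ≡-Reasoning

data Slot (m : ℕ) : Set where
  low  : Fin m → Slot m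
  mid  : Slot m
  high : Fin m → Slot m

high-injective : ∀ {m} {i j : Fin m} → high i ≡ high j → i ≡ j
high-injective refl = refl

slotRank : ∀ {m} → Slot m → ℕ
slotRank     (low i)  = toℕ i
slotRank {m} mid      = m
slotRank {m} (high j) = m + suc (toℕ j)

low<mid : ∀ {m} (i : Fin m) → slotRank (low i) <ℕ slotRank {m} mid
low<mid = toℕ<n

mid<high : ∀ {m} (j : Fin m) → slotRank {m} mid <ℕ slotRank (high j)
mid<high {m} _ = ℕ.m<m+n m z<s

low<high : ∀ {m} (i j : Fin m) → slotRank (low i) <ℕ slotRank (high j)
low<high i j = ℕ.<-trans (low<mid i) (mid<high j)

slotRank-injective : ∀ {m} → Injective _≡_ _≡_ (slotRank {m})
slotRank-injective {m} {low i}  {low j}  e = cong low (toℕ-injective e)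
slotRank-injective {m} {low i}  {mid}    e = contradiction e (ℕ.<⇒≢ (low<mid i))
slotRank-injective {m} {low i}  {high j} e = contradiction e (ℕ.<⇒≢ (low<high i j))
slotRank-injective {m} {mid}    {low j}  e = contradiction e (ℕ.>⇒≢ (low<mid j))
slotRank-injective {m} {mid}    {mid}    _ = refl
slotRank-injective {m} {mid}    {high j} e = contradiction e (ℕ.<⇒≢ (mid<high j))
slotRank-injective {m} {high i} {low j}  e = contradiction e (ℕ.>⇒≢ (low<high j i))
slotRank-injective {m} {high i} {mid}    e = contradiction e (ℕ.>⇒≢ (mid<high i))
slotRank-injective {m} {high i} {high j} e =
  cong high (toℕ-injective (ℕ.suc-injective (ℕ.+-cancelˡ-≡ m _ _ e)))

slotRank<2m+1 : ∀ {m} (p : Slot m) → slotRank p <ℕ suc (2 * m)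
slotRank<2m+1 {m} (low i)  = s≤s (ℕ.≤-trans (ℕ.<⇒≤ (toℕ<n i)) (ℕ.m≤m+n m _))
slotRank<2m+1 {m} mid      = s≤s (ℕ.m≤m+n m _)
slotRank<2m+1 {m} (high j) = s≤s (ℕ.+-monoʳ-≤ m (ℕ.≤-trans (toℕ<n j) (ℕ.m≤m+n m 0)))

slotIndex : ∀ {m} → Slot m → Fin (suc (2 * m))
slotIndex p = fromℕ< (slotRank<2m+1 p)

toℕ-slotIndex : ∀ {m} (p : Slot m) → toℕ (slotIndex p) ≡ slotRank p
toℕ-slotIndex p = toℕ-fromℕ< (slotRank<2m+1 p)

slotIndex-injective : ∀ {m} → Injective _≡_ _≡_ (slotIndex {m})
slotIndex-injective {m} {p} {p′} e =
  slotRank-injective (trans (sym (toℕ-slotIndex p)) (trans (cong toℕ e) (toℕ-slotIndex p′)))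

slotIndex-mono : ∀ {m} (p p′ : Slot m) → slotRank p ≤ℕ slotRank p′ → slotIndex p ≤ᶠ slotIndex p′
slotIndex-mono p p′ = subst₂ _≤ℕ_ (sym (toℕ-slotIndex p)) (sym (toℕ-slotIndex p′))

edgeBetween : ∀ {n} (a b : Fin n) → a ≢ b → Face n
edgeBetween a b a≢b with <-cmp a b
... | tri< a<b _ _ = edge a b a<b
... | tri≈ _ a≡b _ = contradiction a≡b a≢b
... | tri> _ _ b<a = edge b a b<a

∈-edgeBetween⁻ : ∀ {n} {x a b : Fin n} (a≢b : a ≢ b) → x ∈F edgeBetween a b a≢b → x ≡ a ⊎ x ≡ b
∈-edgeBetween⁻ {a = a} {b} a≢b x∈ with <-cmp a b | x∈
... | tri< _ _ _ | x∈′      = x∈′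
... | tri≈ _ a≡b _ | _      = contradiction a≡b a≢b
... | tri> _ _ _ | inj₁ x≡b = inj₂ x≡b
... | tri> _ _ _ | inj₂ x≡a = inj₁ x≡a

left∈edgeBetween : ∀ {n} {a b : Fin n} (a≢b : a ≢ b) → a ∈F edgeBetween a b a≢b
left∈edgeBetween {a = a} {b} a≢b with <-cmp a b
... | tri< _ _ _   = inj₁ refl
... | tri≈ _ a≡b _ = contradiction a≡b a≢b
... | tri> _ _ _   = inj₂ refl

right∈edgeBetween : ∀ {n} {a b : Fin n} (a≢b : a ≢ b) → b ∈F edgeBetween a b a≢b
right∈edgeBetween {a = a} {b} a≢b with <-cmp a b
... | tri< _ _ _   = inj₂ refl
... | tri≈ _ a≡b _ = contradiction a≡b a≢b
... | tri> _ _ _   = inj₁ refl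

module Matching {n m} (vertexAt : Slot m → Fin n) (vertexAt-injective : Injective _≡_ _≡_ vertexAt) where

  low≢high : ∀ i j → vertexAt (low i) ≢ vertexAt (high j)
  low≢high i j e with vertexAt-injective e
  ... | ()

  matching : (Fin m → Fin m) → Fin (suc m) → Face n
  matching π zero    = vertex (vertexAt mid)
  matching π (suc i) = edgeBetween (vertexAt (low i)) (vertexAt (high (π i))) (low≢high i (π i))

  Covers : (Fin m → Fin m) → Fin (suc m) → Slot m → Set
  Covers π zero    p = p ≡ mid
  Covers π (suc i) p = p ≡ low i ⊎ p ≡ high (π i)

  ∈-matching⁻ : ∀ {π x} i → x ∈F matching π i → ∃ λ p → x ≡ vertexAt p × Covers π i p
  ∈-matching⁻ zero    x≡mid = mid , x≡mid , refl
  ∈-matching⁻ (suc i) x∈ with ∈-edgeBetween⁻ _ x∈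
  ... | inj₁ x≡low  = low i , x≡low , inj₁ refl
  ... | inj₂ x≡high = high _ , x≡high , inj₂ refl

  ∈-matching⇒Covers : ∀ {π p} i → vertexAt p ∈F matching π i → Covers π i p
  ∈-matching⇒Covers i p∈ with ∈-matching⁻ i p∈
  ... | _ , e , covers rewrite vertexAt-injective e = covers

  Covers-unique : ∀ {π} → Injective _≡_ _≡_ π → ∀ {i j p} → Covers π i p → Covers π j p → i ≡ j
  Covers-unique π-inj {zero}  {zero}  _ _ = refl
  Covers-unique π-inj {zero}  {suc j} refl (inj₁ ())
  Covers-unique π-inj {zero}  {suc j} refl (inj₂ ())
  Covers-unique π-inj {suc i} {zero}  (inj₁ refl) ()
  Covers-unique π-inj {suc i} {zero}  (inj₂ refl) ()
  Covers-unique π-inj {suc i} {suc j} (inj₁ refl) (inj₁ refl) = refl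
  Covers-unique π-inj {suc i} {suc j} (inj₁ refl) (inj₂ ())
  Covers-unique π-inj {suc i} {suc j} (inj₂ refl) (inj₁ ())
  Covers-unique π-inj {suc i} {suc j} (inj₂ refl) (inj₂ e) = cong suc (π-inj (high-injective e))

  Covers-low : ∀ {π i j} → Covers π j (low i) → j ≡ suc i
  Covers-low {j = suc j} (inj₁ refl) = refl

  Covers-high : ∀ {π i k} → Covers π (suc i) (high k) → π i ≡ k
  Covers-high (inj₂ refl) = refl

  matching-disjoint : ∀ {π} → Injective _≡_ _≡_ π →
                      ∀ i j x → x ∈F matching π i → x ∈F matching π j → i ≡ j
  matching-disjoint π-inj i j x x∈i x∈j with ∈-matching⁻ i x∈i
  ... | p , refl , covers-i = Covers-unique π-inj covers-i (∈-matching⇒Covers j x∈j)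

  -- The lower endpoint of the i-th edge pins down its index in the other
  -- family, and then its upper endpoint pins down π′ i.
  matching-cancel : ∀ {π π′} → SameSet (matching π) (matching π′) → ∀ i → π i ≡ π′ i
  matching-cancel {π} {π′} (sub , _) i = same-face (proj₁ (sub (suc i))) (proj₂ (sub (suc i)))
    where
    covers : ∀ j p → matching π (suc i) ≡ matching π′ j →
             vertexAt p ∈F matching π (suc i) → Covers π′ j p
    covers j p e p∈ = ∈-matching⇒Covers j (subst (vertexAt p ∈F_) e p∈)

    same-face : ∀ j → matching π (suc i) ≡ matching π′ j → π i ≡ π′ i
    same-face j e with Covers-low {π′} (covers j (low i) e (left∈edgeBetween (low≢high i (π i))))
    ... | refl = sym (Covers-high {π′} (covers (suc i) (high (π i)) e
                   (right∈edgeBetween (low≢high i (π i)))))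

module _ {c ℓ₁ ℓ₂ : Level} (O : TotalOrder c ℓ₁ ℓ₂) where
  open TotalOrder O using (_≤_; total; module Eq)
    renaming (Carrier to R; refl to ≤-refl; trans to ≤-trans)

  argmin : ∀ {n} (g : Fin (suc n) → R) → ∃ λ k → ∀ i → g k ≤ g i
  argmin {zero} g = zero , λ { zero → ≤-refl }
  argmin {suc n} g with argmin (g ∘ suc)
  ... | k , gk≤ with total (g zero) (g (suc k))
  ... | inj₁ g0≤gk = zero  , λ { zero → ≤-refl ; (suc i) → ≤-trans g0≤gk (gk≤ i) }
  ... | inj₂ gk≤g0 = suc k , λ { zero → gk≤g0  ; (suc i) → gk≤ i }

  sortingInjection : ∀ {n} (g : Fin n → R) →
                     ∃ λ (s : Fin n → Fin n) → Injective _≡_ _≡_ s × (∀ {i j} → i ≤ᶠ j → g (s i) ≤ g (s j))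
  sortingInjection {zero} g = (λ ()) , (λ { {()} }) , λ { {()} }
  sortingInjection {suc n} g with argmin g
  ... | k , gk≤ with sortingInjection (g ∘ punchIn k)
  ... | s , s-inj , s-mono = insert k s , insert-injective k s-inj , mono
    where
    mono : ∀ {i j} → i ≤ᶠ j → g (insert k s i) ≤ g (insert k s j)
    mono {zero}          _         = gk≤ _
    mono {suc i} {suc j} (s≤s i≤j) = s-mono i≤j

  record MedianSplit {n m} (f : Fin n → R) : Set ℓ₂ where
    field
      vertexAt           : Slot m → Fin n
      vertexAt-injective : Injective _≡_ _≡_ vertexAt
      low≤mid            : ∀ i → f (vertexAt (low i)) ≤ f (vertexAt mid)
      mid≤high           : ∀ j → f (vertexAt mid) ≤ f (vertexAt (high j))

  medianSplit : ∀ {m} (f : Fin (suc (2 * m)) → R) → MedianSplit {m = m} f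
  medianSplit {m} f with sortingInjection f
  ... | s , s-inj , s-mono = record
    { vertexAt           = s ∘ slotIndex
    ; vertexAt-injective = slotIndex-injective ∘ s-inj
    ; low≤mid            = λ i → s-mono (slotIndex-mono (low i) mid (ℕ.<⇒≤ (low<mid i)))
    ; mid≤high           = λ j → s-mono (slotIndex-mono mid (high j) (ℕ.<⇒≤ (mid<high j)))
    }

  hits-edgeBetween : ∀ {n} {f : Fin n → R} {p a b} (a≢b : a ≢ b) →
                     f a ≤ p → p ≤ f b → Hits O f p (edgeBetween a b a≢b)
  hits-edgeBetween {a = a} {b} a≢b fa≤p p≤fb with <-cmp a b
  ... | tri< _ _ _   = lift (inj₁ (fa≤p , p≤fb))
  ... | tri≈ _ a≡b _ = contradiction a≡b a≢b
  ... | tri> _ _ _   = lift (inj₂ (fa≤p , p≤fb))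

  module _ {n m} {f : Fin n → R} (S : MedianSplit {m = m} f) where
    open MedianSplit S
    open Matching vertexAt vertexAt-injective

    matching-isWindingPartition : ∀ {π} → Injective _≡_ _≡_ π → IsWindingPartition O (suc m) f (matching π)
    matching-isWindingPartition {π} π-inj = matching-disjoint π-inj , f (vertexAt mid) , hits
      where
      hits : ∀ i → Hits O f (f (vertexAt mid)) (matching π i)
      hits zero    = lift Eq.refl
      hits (suc i) = hits-edgeBetween _ (low≤mid i) (mid≤high (π i))

mainTheorem5 : ∀ {c ℓ₁ ℓ₂ : Level} (O : TotalOrder c ℓ₁ ℓ₂) (q : ℕ) → q ≥ 1 →
    (f : Fin (nV q) → TotalOrder.Carrier O) →
    AtLeastWinding O q ((q ∸ 1) !) f
mainTheorem5 O zero    () f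
mainTheorem5 O (suc m) _  f =
    (λ a → matching (permutation m a))
  , (λ a → matching-isWindingPartition O split (permutation-injective m a))
  , (λ a b a≢b same → a≢b (permutation-cancel m (matching-cancel same)))
  where
  split : MedianSplit O {m = m} f
  split = medianSplit O f
  open MedianSplit split
  open Matching vertexAt vertexAt-injective
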